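{- Let $M$ be a $\lambda$-term. If there exists a positive resource term $s\in T(M)$ such that $NF^{\neg e}_\epsilon(s)\neq0$, then $M\in S$.
   Context: The set $S$ of $\lambda$-terms is inductively defined: if $M_1,\dots,M_n\in S$ then $xM_1\dots M_n\in S$; if $M\in S$ then $\lambda x.M\in S$; if $M_1\in S$ and $M_0[M_1/x]M_2\dots M_n\in S$ then $(\lambda x.M_0)M_1M_2\dots M_n\in S$. Resource terms $s::=x\mid\lambda x.s\mid\langle s\rangle\bar t$, $\bar t=[t_1,\dots,t_n]$ a finite multiset of resource terms (up to $\alpha$). Finite formal sums with coefficients in $\mathbb N$ ($0$ the empty sum); constructors extended multilinearly. $\partial_x s\cdot[u_1,\dots,u_n]=\sum_{\pi\in\mathfrak S_n}s[u_{\pi(1)}/x_1,\dots,u_{\pi(n)}/x_n]$ if $x_1,\dots,x_n$ enumerate the free occurrences of $x$ in $s$ (exactly $n$), else $0$. Taylor expansion: $T(x)=\{x\}$, $T(\lambda x.M)=\{\lambda x.s\mid s\in T(M)\}$, $T(PQ)=\{\langle s\rangle[t_1,\dots,t_n]\mid s\in T(P),n\ge0,t_i\in T(Q)\}$. $\to^{\neg e}_\partial$: $\langle\lambda x.s\rangle\bar t\to\partial_x s\cdot\bar t$ if $x\in FV(s)$; $\to_{\partial\sigma}$: $\langle\langle\lambda x.s\rangle\bar t\rangle\bar q\to\langle\lambda x.\langle s\rangle\bar q\rangle\bar t$ if $x\notin FV(\bar q)$; both closed under contexts (multilinearly) and on sums by reducing one summand; $\to^{\neg e}_{\partial\epsilon}$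 is their union, which is confluent and strongly normalizing; $NF^{\neg e}_\epsilon(s)$ is the normal form of $s$ (a finite sum, possibly $0$). Positive resource terms: $x$; $\lambda x.s$ with $s$ positive; $\langle s\rangle[t_1,\dots,t_n]$ with $n\ge1$ and $s,t_i$ positive. -}

module Defs where

open import Data.Nat using (ℕ; zero; suc; _+_; _∸_; _<ᵇ_; _≡ᵇ_)
open import Data.Bool using (Bool; true; false; if_then_else_)
open import Data.List using (List; []; _∷_; _++_; map; concatMap; length; foldl)
open import Data.List.Relation.Unary.All using (All)
open import Data.Product using (_×_; _,_; proj₁; proj₂; Σ; ∃)
open import Relation.Binary.Construct.Closure.ReflexiveTransitive using (Star)
open import Relation.Binary.PropositionalEquality using (_≡_; _≢_)
open import Relation.Nullary using (¬_)

-- λ-terms, de Bruijn indices (so α-equivalence is syntactic equality)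

data Λ : Set where
  var : ℕ → Λ
  lam : Λ → Λ
  app : Λ → Λ → Λ

shiftΛ : ℕ → ℕ → Λ → Λ
shiftΛ c d (var y) = if y <ᵇ c then var y else var (y + d)
shiftΛ c d (lam M) = lam (shiftΛ (suc c) d M)
shiftΛ c d (app M N) = app (shiftΛ c d M) (shiftΛ c d N)

-- substΛ k M N : M[N/k] where M sits under k extra binders,
-- and index k is removed (indices above k are decremented)
substΛ : ℕ → Λ → Λ → Λ
substΛ k (var y) N =
  if y ≡ᵇ k then shiftΛ 0 k N else (if y <ᵇ k then var y else var (y ∸ 1))
substΛ k (lam M) N = lam (substΛ (suc k) M N)
substΛ k (app M M') N = app (substΛ k M N) (substΛ k M' N)

-- M₀[M₁/x] for the variable bound by λx.M₀
_[_] : Λ → Λ → Λ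
M₀ [ M₁ ] = substΛ 0 M₀ M₁

apps : Λ → List Λ → Λ
apps M Ns = foldl app M Ns

data InS : Λ → Set where
  sVar : ∀ x (Ms : List Λ) → All InS Ms → InS (apps (var x) Ms)
  sLam : ∀ {M} → InS M → InS (lam M)
  sRed : ∀ M₀ M₁ (Ms : List Λ) → InS M₁ → InS (apps (M₀ [ M₁ ]) Ms) →
         InS (apps (app (lam M₀) M₁) Ms)

-- resource terms; bags [t₁,…,tₙ] are lists read up to permutation,
-- finite sums with ℕ coefficients are lists of terms (0 = [])

data RT : Set where
  rvar : ℕ → RT
  rlam : RT → RT
  rapp : RT → List RT → RT

Sum : Set
Sum = List RT

mutual
  shiftR : ℕ → ℕ → RT → RT
  shiftR c d (rvar y) = if y <ᵇ c then rvar y else rvar (y + d)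
  shiftR c d (rlam s) = rlam (shiftR (suc c) d s)
  shiftR c d (rapp s ts) = rapp (shiftR c d s) (shiftRs c d ts)

  shiftRs : ℕ → ℕ → List RT → List RT
  shiftRs c d [] = []
  shiftRs c d (t ∷ ts) = shiftR c d t ∷ shiftRs c d ts

mutual
  occ : ℕ → RT → ℕ
  occ k (rvar y) = if y ≡ᵇ k then 1 else 0
  occ k (rlam s) = occ (suc k) s
  occ k (rapp s ts) = occ k s + occs k ts

  occs : ℕ → List RT → ℕ
  occs k [] = 0
  occs k (t ∷ ts) = occ k t + occs k ts

-- linear substitution: the occurrences of index k (from left to right)
-- are replaced by the successive elements of the list; index k is removed
mutual
  fill : ℕ → RT → List RT → RT × List RT
  fill k (rvar y) us with y ≡ᵇ k
  ... | true with us
  ...   | [] = rvar y , []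
  ...   | u ∷ us' = shiftR 0 k u , us'
  fill k (rvar y) us | false =
    (if y <ᵇ k then rvar y else rvar (y ∸ 1)) , us
  fill k (rlam s) us with fill (suc k) s us
  ... | s' , us' = rlam s' , us'
  fill k (rapp s ts) us with fill k s us
  ... | s' , us' with fills k ts us'
  ...   | ts' , us'' = rapp s' ts' , us''

  fills : ℕ → List RT → List RT → List RT × List RT
  fills k [] us = [] , us
  fills k (t ∷ ts) us with fill k t us
  ... | t' , us' with fills k ts us'
  ...   | ts' , us'' = (t' ∷ ts') , us''

-- all permutations (as a list of n! lists, with repetitions)
insertions : {A : Set} → A → List A → List (List A)
insertions x [] = (x ∷ []) ∷ []
insertions x (y ∷ ys) = (x ∷ y ∷ ys) ∷ map (y ∷_) (insertions x ys)

perms : {A : Set} → List A → List (List A)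
perms [] = [] ∷ []
perms (x ∷ xs) = concatMap (insertions x) (perms xs)

-- ∂ₓ s · ū, where x is index 0 of the body s
deriv : RT → List RT → Sum
deriv s us with occ 0 s ≡ᵇ length us
... | true = map (λ p → proj₁ (fill 0 s p)) (perms us)
... | false = []

data _↦_ : RT → Sum → Set where
  ∂β : ∀ s ts → occ 0 s ≢ 0 → rapp (rlam s) ts ↦ deriv s ts
  ∂σ : ∀ s ts qs →
       rapp (rapp (rlam s) ts) qs ↦ (rapp (rlam (rapp s (shiftRs 0 1 qs))) ts ∷ [])
  cLam : ∀ {s σ} → s ↦ σ → rlam s ↦ map rlam σ
  cFun : ∀ {s σ} ts → s ↦ σ → rapp s ts ↦ map (λ s' → rapp s' ts) σ
  cArg : ∀ {t σ} s ts₁ ts₂ → t ↦ σ →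
         rapp s (ts₁ ++ t ∷ ts₂) ↦ map (λ t' → rapp s (ts₁ ++ t' ∷ ts₂)) σ

data _⇒_ : Sum → Sum → Set where
  step : ∀ σ₁ σ₂ {s τ} → s ↦ τ → (σ₁ ++ s ∷ σ₂) ⇒ (σ₁ ++ τ ++ σ₂)

_⇒*_ : Sum → Sum → Set
_⇒*_ = Star _⇒_

Normal : Sum → Set
Normal σ = ∀ τ → ¬ (σ ⇒ τ)

NFnonzero : RT → Set
NFnonzero s = Σ Sum λ σ → ((s ∷ []) ⇒* σ) × Normal σ × (σ ≢ [])

data _∈T_ : RT → Λ → Set where
  tVar : ∀ x → rvar x ∈T var x
  tLam : ∀ {s M} → s ∈T M → rlam s ∈T lam M
  tApp : ∀ {s ts P Q} → s ∈T P → All (_∈T Q) ts → rapp s ts ∈T app P Q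

data Positive : RT → Set where
  pVar : ∀ x → Positive (rvar x)
  pLam : ∀ {s} → Positive s → Positive (rlam s)
  pApp : ∀ {s t ts} → Positive s → All Positive (t ∷ ts) → Positive (rapp s (t ∷ ts))

module Submission where

-- The proof goes through non-idempotent intersection types for resource
-- terms, with an extra type constructor ω B for abstractions whose bound
-- variable does not occur (the redexes that ¬e-reduction cannot fire).
--  (1) Typing is invariant under shifting and satisfies a linear
--      substitution lemma and its converse (anti-substitution).
--  (2) Hence typing is preserved by subject EXPANSION along ∂β and ∂σ,
--      while every normal resource term is typable; so a term whose
--      normal form is a non-empty sum is typable.
--  (3) A typed positive s ∈ T(M) shows M ∈ S, by induction on the size
--      of s decomposed as a head applied to a spine of bags: a variable
--      head gives the first rule of S, and a λ-head applied to a bag is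
--      contracted along the typing (the bag length matches the number of
--      occurrences) into a smaller typed positive term of T(M₀[M₁/x]).

open import Defs
open import Algebra.Bundles using (CommutativeMonoid)
import Algebra.Construct.Pointwise as Pointwise
import Algebra.Properties.CommutativeSemigroup as CommutativeSemigroupProperties
open import Data.Bool using (true; false; if_then_else_; T)
open import Data.Empty using (⊥; ⊥-elim)
open import Data.List using (List; []; _∷_; _++_; length; concatMap; map)
open import Data.List.Relation.Binary.Pointwise using (Pointwise; []; _∷_)
open import Data.List.Properties using (++-assoc; length-++; ++-conicalˡ)
open import Data.List.Membership.Propositional using (_∈_)
open import Data.List.Membership.Propositional.Properties using (∈-map⁻; ∈-++⁻; ∈-++⁺ˡ; ∈-++⁺ʳ; ∈-∃++)
open import Data.List.Relation.Binary.Permutation.Propositional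
  using (_↭_; ↭-refl; ↭-sym; ↭-trans; ↭-reflexive; prep; swap)
import Data.List.Relation.Binary.Permutation.Propositional as ↭
import Data.List.Relation.Binary.Permutation.Propositional.Properties as ↭ₚ
open import Data.List.Relation.Unary.All using (All; []; _∷_)
open import Data.List.Relation.Unary.All.Properties using (++⁻ˡ; ++⁻ʳ)
open import Data.List.Relation.Unary.Any using (here; there)
open import Data.Nat using (ℕ; zero; suc; _+_; _∸_; _<ᵇ_; _≡ᵇ_; _≤_; z≤n; s≤s; _≟_)
open import Data.Nat.ListAction using (sum)
open import Data.Nat.ListAction.Properties using (sum-↭)
open import Data.Nat.Properties
  using (+-commutativeSemigroup; +-assoc; +-comm; +-suc; +-identityʳ; suc-injective; ≡ᵇ⇒≡; ≤-refl; ≤-trans; ≤-reflexive;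
         +-mono-≤; +-monoˡ-≤; +-monoʳ-≤; m≤m+n; m≤n+m; n≤1+n)
open import Data.Product using (Σ; _×_; _,_; proj₁; proj₂)
open import Data.Sum using (inj₁; inj₂)
open import Data.Unit using (tt)
open import Relation.Binary.Construct.Closure.ReflexiveTransitive using (ε; _◅_)
open import Relation.Binary.PropositionalEquality using (_≡_; refl; sym; trans; cong; cong₂; subst)
open import Relation.Nullary using (¬_; yes; no)

-- A list of types stands for a multiset (read up to
-- ↭); L ⟶ B types an abstraction using its variable once per element of
-- L, and ω B an abstraction whose variable does not occur.
data Ty : Set where
  base : Ty
  _⟶_ : List Ty → Ty → Ty
  ω : Ty → Ty

Ctx : Set
Ctx = ℕ → List Ty

infix 4 _≈_
_≈_ : Ctx → Ctx → Set
Θ ≈ Θ' = ∀ k → Θ k ↭ Θ' k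

∅ : Ctx
∅ _ = []

infixl 6 _⊕_
_⊕_ : Ctx → Ctx → Ctx
(Θ₁ ⊕ Θ₂) k = Θ₁ k ++ Θ₂ k

ctxMonoid : CommutativeMonoid _ _
ctxMonoid = Pointwise.commutativeMonoid ℕ (↭ₚ.++-commutativeMonoid {A = Ty})

open CommutativeMonoid ctxMonoid
  using () renaming (refl to ≈-refl; sym to ≈-sym; trans to ≈-trans; ∙-cong to ⊕-cong;
                     assoc to ⊕-assoc; identityˡ to ⊕-identityˡ; identityʳ to ⊕-identityʳ)
open CommutativeSemigroupProperties (CommutativeMonoid.commutativeSemigroup ctxMonoid)
  using () renaming (interchange to ⊕-interchange; x∙yz≈y∙xz to ⊕-swapˡ; xy∙z≈xz∙y to ⊕-swapʳ)
open CommutativeSemigroupProperties +-commutativeSemigroup using () renaming (interchange to +-interchange)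

-- Contexts under binders: dropping/adding index 0, inserting d empty
-- slots at position c (the effect of shiftR c d) and deleting slot k
-- (the effect of substituting for index k).
tailC : Ctx → Ctx
tailC Θ k = Θ (suc k)

consC : List Ty → Ctx → Ctx
consC X Θ zero = X
consC X Θ (suc k) = Θ k

pad : ℕ → Ctx → Ctx
pad zero Θ = Θ
pad (suc d) Θ = consC [] (pad d Θ)

shiftC : ℕ → ℕ → Ctx → Ctx
shiftC zero d Θ = pad d Θ
shiftC (suc c) d Θ = consC (Θ 0) (shiftC c d (tailC Θ))

downC : ℕ → Ctx → Ctx
downC zero Θ = tailC Θ
downC (suc k) Θ = consC (Θ 0) (downC k (tailC Θ))

single : ℕ → Ty → Ctx
single y A k = if y ≡ᵇ k then A ∷ [] else []

tail-cong : ∀ {Θ Θ'} → Θ ≈ Θ' → tailC Θ ≈ tailC Θ'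
tail-cong e k = e (suc k)

cons-cong : ∀ {X Y Θ Θ'} → X ↭ Y → Θ ≈ Θ' → consC X Θ ≈ consC Y Θ'
cons-cong p e zero = p
cons-cong p e (suc k) = e k

cons-⊕ : ∀ X Y Θ₁ Θ₂ → consC (X ++ Y) (Θ₁ ⊕ Θ₂) ≈ consC X Θ₁ ⊕ consC Y Θ₂
cons-⊕ X Y Θ₁ Θ₂ zero = ↭-refl
cons-⊕ X Y Θ₁ Θ₂ (suc k) = ↭-refl

cons-∅ : consC [] ∅ ≈ ∅
cons-∅ zero = ↭-refl
cons-∅ (suc k) = ↭-refl

pad-cong : ∀ d {Θ Θ'} → Θ ≈ Θ' → pad d Θ ≈ pad d Θ'
pad-cong zero e = e
pad-cong (suc d) e = cons-cong ↭-refl (pad-cong d e)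

pad-⊕ : ∀ d Θ₁ Θ₂ → pad d (Θ₁ ⊕ Θ₂) ≈ pad d Θ₁ ⊕ pad d Θ₂
pad-⊕ zero Θ₁ Θ₂ = ≈-refl
pad-⊕ (suc d) Θ₁ Θ₂ = ≈-trans (cons-cong ↭-refl (pad-⊕ d Θ₁ Θ₂)) (cons-⊕ [] [] _ _)

pad-∅ : ∀ d → pad d ∅ ≈ ∅
pad-∅ zero = ≈-refl
pad-∅ (suc d) = ≈-trans (cons-cong ↭-refl (pad-∅ d)) cons-∅

shiftC-cong : ∀ c d {Θ Θ'} → Θ ≈ Θ' → shiftC c d Θ ≈ shiftC c d Θ'
shiftC-cong zero d e = pad-cong d e
shiftC-cong (suc c) d e = cons-cong (e 0) (shiftC-cong c d (tail-cong e))

shiftC-⊕ : ∀ c d Θ₁ Θ₂ → shiftC c d (Θ₁ ⊕ Θ₂) ≈ shiftC c d Θ₁ ⊕ shiftC c d Θ₂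
shiftC-⊕ zero d = pad-⊕ d
shiftC-⊕ (suc c) d Θ₁ Θ₂ = ≈-trans (cons-cong ↭-refl (shiftC-⊕ c d _ _)) (cons-⊕ _ _ _ _)

shiftC-∅ : ∀ c d → shiftC c d ∅ ≈ ∅
shiftC-∅ zero d = pad-∅ d
shiftC-∅ (suc c) d = ≈-trans (cons-cong ↭-refl (shiftC-∅ c d)) cons-∅

downC-cong : ∀ k {Θ Θ'} → Θ ≈ Θ' → downC k Θ ≈ downC k Θ'
downC-cong zero e = tail-cong e
downC-cong (suc k) e = cons-cong (e 0) (downC-cong k (tail-cong e))

downC-⊕ : ∀ k Θ₁ Θ₂ → downC k (Θ₁ ⊕ Θ₂) ≈ downC k Θ₁ ⊕ downC k Θ₂
downC-⊕ zero Θ₁ Θ₂ = ≈-refl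
downC-⊕ (suc k) Θ₁ Θ₂ = ≈-trans (cons-cong ↭-refl (downC-⊕ k _ _)) (cons-⊕ _ _ _ _)

downC-∅ : ∀ k → downC k ∅ ≈ ∅
downC-∅ zero = ≈-refl
downC-∅ (suc k) = ≈-trans (cons-cong ↭-refl (downC-∅ k)) cons-∅

-- Typing of resource terms and of bags (a bag gets a list of types, one
-- per element).  Contexts are taken up to ≈ at every rule, so that the
-- judgement is closed under ≈ (⊢-resp-≈).
mutual
  data _⊢_∶_ : Ctx → RT → Ty → Set where
    tvar : ∀ {Θ y A} → Θ ≈ single y A → Θ ⊢ rvar y ∶ A
    tlam : ∀ {Θ Θ' s L B} → Θ' ⊢ s ∶ B → L ↭ Θ' 0 → Θ ≈ tailC Θ' → Θ ⊢ rlam s ∶ (L ⟶ B)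
    tlamω : ∀ {Θ Θ' s B} → Θ' ⊢ s ∶ B → Θ' 0 ↭ [] → Θ ≈ tailC Θ' → Θ ⊢ rlam s ∶ ω B
    tapp : ∀ {Θ Θ₁ Θ₂ s ts Us L B} → Θ₁ ⊢ s ∶ (L ⟶ B) → BagTy Θ₂ ts Us → Us ↭ L →
           Θ ≈ Θ₁ ⊕ Θ₂ → Θ ⊢ rapp s ts ∶ B
    tappω : ∀ {Θ Θ₁ Θ₂ s ts Us B} → Θ₁ ⊢ s ∶ ω B → BagTy Θ₂ ts Us →
            Θ ≈ Θ₁ ⊕ Θ₂ → Θ ⊢ rapp s ts ∶ B

  data BagTy : Ctx → List RT → List Ty → Set where
    bnil : ∀ {Θ} → Θ ≈ ∅ → BagTy Θ [] []
    bcons : ∀ {Θ Θ₁ Θ₂ t ts U Us} → Θ₁ ⊢ t ∶ U → BagTy Θ₂ ts Us → Θ ≈ Θ₁ ⊕ Θ₂ →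
            BagTy Θ (t ∷ ts) (U ∷ Us)

Typable : RT → Set
Typable s = Σ Ctx λ Θ → Σ Ty λ A → Θ ⊢ s ∶ A

⊢-resp-≈ : ∀ {Θ Θ' s A} → Θ ⊢ s ∶ A → Θ ≈ Θ' → Θ' ⊢ s ∶ A
⊢-resp-≈ (tvar e) f = tvar (≈-trans (≈-sym f) e)
⊢-resp-≈ (tlam D p e) f = tlam D p (≈-trans (≈-sym f) e)
⊢-resp-≈ (tlamω D p e) f = tlamω D p (≈-trans (≈-sym f) e)
⊢-resp-≈ (tapp D b p e) f = tapp D b p (≈-trans (≈-sym f) e)
⊢-resp-≈ (tappω D b e) f = tappω D b (≈-trans (≈-sym f) e)

bag-resp-≈ : ∀ {Θ Θ' ts Us} → BagTy Θ ts Us → Θ ≈ Θ' → BagTy Θ' ts Us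
bag-resp-≈ (bnil e) f = bnil (≈-trans (≈-sym f) e)
bag-resp-≈ (bcons D b e) f = bcons D b (≈-trans (≈-sym f) e)

shiftV : ℕ → ℕ → ℕ → ℕ
shiftV c d y = if y <ᵇ c then y else y + d

downV : ℕ → ℕ → ℕ
downV k y = if y <ᵇ k then y else y ∸ 1

shiftR-var : ∀ c d y → shiftR c d (rvar y) ≡ rvar (shiftV c d y)
shiftR-var c d y with y <ᵇ c
... | true = refl
... | false = refl

single-≡ : ∀ {y z} A → y ≡ z → single y A ≈ single z A
single-≡ A refl = ≈-refl

single-suc : ∀ z A → single (suc z) A ≈ consC [] (single z A)
single-suc z A zero = ↭-refl
single-suc z A (suc k) = ↭-refl

single-0 : ∀ A → single 0 A ≈ consC (A ∷ []) ∅
single-0 A zero = ↭-refl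
single-0 A (suc k) = ↭-refl

tail-single-0 : ∀ A → tailC (single 0 A) ≈ ∅
tail-single-0 A k = ↭-refl

pad-single : ∀ d y A → pad d (single y A) ≈ single (d + y) A
pad-single zero y A = ≈-refl
pad-single (suc d) y A =
  ≈-trans (cons-cong ↭-refl (pad-single d y A)) (≈-sym (single-suc (d + y) A))

shift-single : ∀ c d y A → shiftC c d (single y A) ≈ single (shiftV c d y) A
shift-single zero d y A = ≈-trans (pad-single d y A) (single-≡ A (+-comm d y))
shift-single (suc c) d zero A =
  ≈-trans (cons-cong ↭-refl (≈-trans (shiftC-cong c d (tail-single-0 A)) (shiftC-∅ c d)))
          (≈-sym (single-0 A))
shift-single (suc c) d (suc y) A =
  ≈-trans (cons-cong ↭-refl (shift-single c d y A))
          (≈-trans (≈-sym (single-suc _ A)) (single-≡ A (suc-shiftV (y <ᵇ c))))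
  where
  suc-shiftV : ∀ b → suc (if b then y else y + d) ≡ (if b then suc y else suc (y + d))
  suc-shiftV true = refl
  suc-shiftV false = refl

down-single-same : ∀ k A → downC k (single k A) ≈ ∅
down-single-same zero A k = ↭-refl
down-single-same (suc k) A = ≈-trans (cons-cong ↭-refl (down-single-same k A)) cons-∅

down-single : ∀ k y A → (y ≡ᵇ k) ≡ false → downC k (single y A) ≈ single (downV k y) A
down-single zero (suc y) A e = ≈-refl
down-single (suc k) zero A e =
  ≈-trans (cons-cong ↭-refl (≈-trans (downC-cong k (tail-single-0 A)) (downC-∅ k)))
          (≈-sym (single-0 A))
down-single (suc k) (suc y) A e =
  ≈-trans (cons-cong ↭-refl (down-single k y A e))
          (≈-trans (≈-sym (single-suc _ A)) (single-≡ A (suc-downV k y e)))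
  where
  suc-downV : ∀ k y → (y ≡ᵇ k) ≡ false → suc (downV k y) ≡ downV (suc k) (suc y)
  suc-downV zero (suc y) e = refl
  suc-downV (suc k) zero e = refl
  suc-downV (suc k) (suc y) e with y <ᵇ k
  ... | true = refl
  ... | false = refl

mutual
  shift-ty : ∀ c d {Θ u A} → Θ ⊢ u ∶ A → shiftC c d Θ ⊢ shiftR c d u ∶ A
  shift-ty c d {u = rvar y} {A} (tvar e) =
    subst (λ t → shiftC c d _ ⊢ t ∶ A) (sym (shiftR-var c d y))
      (tvar (≈-trans (shiftC-cong c d e) (shift-single c d y A)))
  shift-ty c d (tlam D p e) = tlam (shift-ty (suc c) d D) p (shiftC-cong c d e)
  shift-ty c d (tlamω D p e) = tlamω (shift-ty (suc c) d D) p (shiftC-cong c d e)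
  shift-ty c d (tapp D b p e) =
    tapp (shift-ty c d D) (shift-bag c d b) p (≈-trans (shiftC-cong c d e) (shiftC-⊕ c d _ _))
  shift-ty c d (tappω D b e) =
    tappω (shift-ty c d D) (shift-bag c d b) (≈-trans (shiftC-cong c d e) (shiftC-⊕ c d _ _))

  shift-bag : ∀ c d {Θ ts Us} → BagTy Θ ts Us → BagTy (shiftC c d Θ) (shiftRs c d ts) Us
  shift-bag c d (bnil e) = bnil (≈-trans (shiftC-cong c d e) (shiftC-∅ c d))
  shift-bag c d (bcons D b e) =
    bcons (shift-ty c d D) (shift-bag c d b) (≈-trans (shiftC-cong c d e) (shiftC-⊕ c d _ _))

Unshifted : ℕ → ℕ → Ctx → RT → Ty → Set
Unshifted c d Θ u A = Σ Ctx λ Θu → (Θu ⊢ u ∶ A) × (Θ ≈ shiftC c d Θu)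

UnshiftedBag : ℕ → ℕ → Ctx → List RT → List Ty → Set
UnshiftedBag c d Θ ts Us = Σ Ctx λ Θu → BagTy Θu ts Us × (Θ ≈ shiftC c d Θu)

mutual
  unshift-ty : ∀ c d u {Θ A} → Θ ⊢ shiftR c d u ∶ A → Unshifted c d Θ u A
  unshift-ty c d (rvar y) {Θ} {A} D with subst (λ t → Θ ⊢ t ∶ A) (shiftR-var c d y) D
  ... | tvar e = single y A , tvar ≈-refl , ≈-trans e (≈-sym (shift-single c d y A))
  unshift-ty c d (rlam s) (tlam D p e) with unshift-ty (suc c) d s D
  ... | Θs , Ds , f = tailC Θs , tlam Ds (↭-trans p (f 0)) ≈-refl , ≈-trans e (tail-cong f)
  unshift-ty c d (rlam s) (tlamω D p e) with unshift-ty (suc c) d s D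
  ... | Θs , Ds , f = tailC Θs , tlamω Ds (↭-trans (↭-sym (f 0)) p) ≈-refl , ≈-trans e (tail-cong f)
  unshift-ty c d (rapp s ts) (tapp D b p e) with unshift-ty c d s D | unshift-bag c d ts b
  ... | Θ₁ , D₁ , f₁ | Θ₂ , b₂ , f₂ =
    Θ₁ ⊕ Θ₂ , tapp D₁ b₂ p ≈-refl , ≈-trans e (≈-trans (⊕-cong f₁ f₂) (≈-sym (shiftC-⊕ c d _ _)))
  unshift-ty c d (rapp s ts) (tappω D b e) with unshift-ty c d s D | unshift-bag c d ts b
  ... | Θ₁ , D₁ , f₁ | Θ₂ , b₂ , f₂ =
    Θ₁ ⊕ Θ₂ , tappω D₁ b₂ ≈-refl , ≈-trans e (≈-trans (⊕-cong f₁ f₂) (≈-sym (shiftC-⊕ c d _ _)))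

  unshift-bag : ∀ c d ts {Θ Us} → BagTy Θ (shiftRs c d ts) Us → UnshiftedBag c d Θ ts Us
  unshift-bag c d [] (bnil e) = ∅ , bnil ≈-refl , ≈-trans e (≈-sym (shiftC-∅ c d))
  unshift-bag c d (t ∷ ts) (bcons D b e) with unshift-ty c d t D | unshift-bag c d ts b
  ... | Θ₁ , D₁ , f₁ | Θ₂ , b₂ , f₂ =
    Θ₁ ⊕ Θ₂ , bcons D₁ b₂ ≈-refl , ≈-trans e (≈-trans (⊕-cong f₁ f₂) (≈-sym (shiftC-⊕ c d _ _)))

plug : ℕ → RT → List RT → RT
plug k s xs = proj₁ (fill k s xs)

plugs : ℕ → List RT → List RT → List RT
plugs k ts xs = proj₁ (fills k ts xs)

-- Unfolding equations for fill (its with-clauses hide them).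
fill-lam : ∀ k s xs → fill k (rlam s) xs ≡ (rlam (plug (suc k) s xs) , proj₂ (fill (suc k) s xs))
fill-lam k s xs with fill (suc k) s xs
... | s' , xs' = refl

fill-app : ∀ k s ts xs → fill k (rapp s ts) xs ≡
  (rapp (plug k s xs) (plugs k ts (proj₂ (fill k s xs))) , proj₂ (fills k ts (proj₂ (fill k s xs))))
fill-app k s ts xs with fill k s xs
... | s' , xs' with fills k ts xs'
...   | ts' , xs'' = refl

fills-cons : ∀ k t ts xs → fills k (t ∷ ts) xs ≡
  (plug k t xs ∷ plugs k ts (proj₂ (fill k t xs)) , proj₂ (fills k ts (proj₂ (fill k t xs))))
fills-cons k t ts xs with fill k t xs
... | t' , xs' with fills k ts xs'
...   | ts' , xs'' = refl

fill-var-other : ∀ k y → (if y <ᵇ k then rvar y else rvar (y ∸ 1)) ≡ rvar (downV k y)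
fill-var-other k y with y <ᵇ k
... | true = refl
... | false = refl

split : ∀ {A : Set} (xs : List A) a b → length xs ≡ a + b →
        Σ (List A) λ xs₁ → Σ (List A) λ xs₂ → xs ≡ xs₁ ++ xs₂ × length xs₁ ≡ a × length xs₂ ≡ b
split xs zero b e = [] , xs , refl , refl , e
split (x ∷ xs) (suc a) b e with split xs a b (suc-injective e)
... | xs₁ , xs₂ , refl , e₁ , e₂ = x ∷ xs₁ , xs₂ , refl , cong suc e₁ , e₂

mutual
  fill-exact : ∀ k s xs ys → length xs ≡ occ k s → fill k s (xs ++ ys) ≡ (plug k s xs , ys)
  fill-exact k (rvar y) xs ys e with y ≡ᵇ k
  fill-exact k (rvar y) (x ∷ []) ys e | true = refl
  fill-exact k (rvar y) [] ys e | false = refl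
  fill-exact k (rlam s) xs ys e
    rewrite fill-lam k s (xs ++ ys) | fill-lam k s xs | fill-exact (suc k) s xs ys e = refl
  fill-exact k (rapp s ts) xs ys e with split xs (occ k s) (occs k ts) e
  ... | xs₁ , xs₂ , refl , e₁ , e₂
    rewrite fill-app k s ts ((xs₁ ++ xs₂) ++ ys) | fill-app k s ts (xs₁ ++ xs₂)
          | ++-assoc xs₁ xs₂ ys
          | fill-exact k s xs₁ (xs₂ ++ ys) e₁ | fill-exact k s xs₁ xs₂ e₁
          | fills-exact k ts xs₂ ys e₂ = refl

  fills-exact : ∀ k ts xs ys → length xs ≡ occs k ts → fills k ts (xs ++ ys) ≡ (plugs k ts xs , ys)
  fills-exact k [] [] ys e = refl
  fills-exact k (t ∷ ts) xs ys e with split xs (occ k t) (occs k ts) e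
  ... | xs₁ , xs₂ , refl , e₁ , e₂
    rewrite fills-cons k t ts ((xs₁ ++ xs₂) ++ ys) | fills-cons k t ts (xs₁ ++ xs₂)
          | ++-assoc xs₁ xs₂ ys
          | fill-exact k t xs₁ (xs₂ ++ ys) e₁ | fill-exact k t xs₁ xs₂ e₁
          | fills-exact k ts xs₂ ys e₂ = refl

plug-app : ∀ k s ts xs₁ xs₂ → length xs₁ ≡ occ k s →
  plug k (rapp s ts) (xs₁ ++ xs₂) ≡ rapp (plug k s xs₁) (plugs k ts xs₂)
plug-app k s ts xs₁ xs₂ e rewrite fill-app k s ts (xs₁ ++ xs₂) | fill-exact k s xs₁ xs₂ e = refl

plugs-cons : ∀ k t ts xs₁ xs₂ → length xs₁ ≡ occ k t →
  plugs k (t ∷ ts) (xs₁ ++ xs₂) ≡ plug k t xs₁ ∷ plugs k ts xs₂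
plugs-cons k t ts xs₁ xs₂ e rewrite fills-cons k t ts (xs₁ ++ xs₂) | fill-exact k t xs₁ xs₂ e = refl

≡ᵇ-true⇒≡ : ∀ y k → (y ≡ᵇ k) ≡ true → y ≡ k
≡ᵇ-true⇒≡ y k eq = ≡ᵇ⇒≡ y k (subst T (sym eq) tt)

mutual
  occTys : ∀ {Θ s A} → ℕ → Θ ⊢ s ∶ A → List Ty
  occTys k (tvar {y = y} {A} e) = if y ≡ᵇ k then A ∷ [] else []
  occTys k (tlam D p e) = occTys (suc k) D
  occTys k (tlamω D p e) = occTys (suc k) D
  occTys k (tapp D b p e) = occTys k D ++ occTysB k b
  occTys k (tappω D b e) = occTys k D ++ occTysB k b

  occTysB : ∀ {Θ ts Us} → ℕ → BagTy Θ ts Us → List Ty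
  occTysB k (bnil e) = []
  occTysB k (bcons D b e) = occTys k D ++ occTysB k b

mutual
  occTys-length : ∀ {Θ s A} k (D : Θ ⊢ s ∶ A) → length (occTys k D) ≡ occ k s
  occTys-length k (tvar {y = y} e) with y ≡ᵇ k
  ... | true = refl
  ... | false = refl
  occTys-length k (tlam D p e) = occTys-length (suc k) D
  occTys-length k (tlamω D p e) = occTys-length (suc k) D
  occTys-length k (tapp D b p e) =
    trans (length-++ (occTys k D)) (cong₂ _+_ (occTys-length k D) (occTysB-length k b))
  occTys-length k (tappω D b e) =
    trans (length-++ (occTys k D)) (cong₂ _+_ (occTys-length k D) (occTysB-length k b))

  occTysB-length : ∀ {Θ ts Us} k (b : BagTy Θ ts Us) → length (occTysB k b) ≡ occs k ts
  occTysB-length k (bnil e) = refl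
  occTysB-length k (bcons D b e) =
    trans (length-++ (occTys k D)) (cong₂ _+_ (occTys-length k D) (occTysB-length k b))

mutual
  occTys-↭ : ∀ {Θ s A} k (D : Θ ⊢ s ∶ A) → occTys k D ↭ Θ k
  occTys-↭ k (tvar e) = ↭-sym (e k)
  occTys-↭ k (tlam D p e) = ↭-trans (occTys-↭ (suc k) D) (↭-sym (e k))
  occTys-↭ k (tlamω D p e) = ↭-trans (occTys-↭ (suc k) D) (↭-sym (e k))
  occTys-↭ k (tapp D b p e) = ↭-trans (↭ₚ.++⁺ (occTys-↭ k D) (occTysB-↭ k b)) (↭-sym (e k))
  occTys-↭ k (tappω D b e) = ↭-trans (↭ₚ.++⁺ (occTys-↭ k D) (occTysB-↭ k b)) (↭-sym (e k))

  occTysB-↭ : ∀ {Θ ts Us} k (b : BagTy Θ ts Us) → occTysB k b ↭ Θ k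
  occTysB-↭ k (bnil e) = ↭-sym (e k)
  occTysB-↭ k (bcons D b e) = ↭-trans (↭ₚ.++⁺ (occTys-↭ k D) (occTysB-↭ k b)) (↭-sym (e k))

bag-++ : ∀ {Θ₁ Θ₂ xs ys Us Vs} → BagTy Θ₁ xs Us → BagTy Θ₂ ys Vs →
         BagTy (Θ₁ ⊕ Θ₂) (xs ++ ys) (Us ++ Vs)
bag-++ {Θ₂ = Θ₂} (bnil e) b = bag-resp-≈ b (≈-sym (≈-trans (⊕-cong e ≈-refl) (⊕-identityˡ Θ₂)))
bag-++ {Θ₂ = Θ₂} (bcons {Θ₁ = Θa} {Θ₂ = Θb} D b₁ e) b =
  bcons D (bag-++ b₁ b) (≈-trans (⊕-cong e ≈-refl) (⊕-assoc Θa Θb Θ₂))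

BagSplit : Ctx → List RT → List Ty → List Ty → Set
BagSplit Θ xs Us Vs = Σ (List RT) λ xs₁ → Σ (List RT) λ xs₂ → Σ Ctx λ Θ₁ → Σ Ctx λ Θ₂ →
  (xs ≡ xs₁ ++ xs₂) × BagTy Θ₁ xs₁ Us × BagTy Θ₂ xs₂ Vs × (Θ ≈ Θ₁ ⊕ Θ₂)

bag-split : ∀ {Θ xs} Us {Vs} → BagTy Θ xs (Us ++ Vs) → BagSplit Θ xs Us Vs
bag-split {Θ} {xs} [] b = [] , xs , ∅ , Θ , refl , bnil ≈-refl , b , ≈-sym (⊕-identityˡ Θ)
bag-split (U ∷ Us) (bcons {Θ₁ = Θa} D b e) with bag-split Us b
... | xs₁ , xs₂ , Θ₁ , Θ₂ , refl , b₁ , b₂ , f =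
  _ ∷ xs₁ , xs₂ , Θa ⊕ Θ₁ , Θ₂ , refl , bcons D b₁ ≈-refl , b₂ ,
  ≈-trans e (≈-trans (⊕-cong ≈-refl f) (≈-sym (⊕-assoc Θa Θ₁ Θ₂)))

bag-length : ∀ {Θ xs Us} → BagTy Θ xs Us → length xs ≡ length Us
bag-length (bnil e) = refl
bag-length (bcons D b e) = cong suc (bag-length b)

bag-nil : ∀ {Θ xs} → BagTy Θ xs [] → (xs ≡ []) × (Θ ≈ ∅)
bag-nil (bnil e) = refl , e

bag-one : ∀ {Θ xs A} → BagTy Θ xs (A ∷ []) →
  Σ RT λ x → (xs ≡ x ∷ []) × (Θ ⊢ x ∶ A)
bag-one (bcons {Θ₁ = Θ₁} D (bnil e') e) =
  _ , refl , ⊢-resp-≈ D (≈-sym (≈-trans e (≈-trans (⊕-cong ≈-refl e') (⊕-identityʳ Θ₁))))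

substCtx : ℕ → Ctx → Ctx → Ctx
substCtx k Θ₀ Θx = downC k Θ₀ ⊕ shiftC 0 k Θx

substCtx-cong : ∀ k {Θ₀ Θ₀' Θx Θx'} → Θ₀ ≈ Θ₀' → Θx ≈ Θx' → substCtx k Θ₀ Θx ≈ substCtx k Θ₀' Θx'
substCtx-cong k e f = ⊕-cong (downC-cong k e) (shiftC-cong 0 k f)

substCtx-⊕ : ∀ k Θa Θb Θ₁ Θ₂ → substCtx k (Θa ⊕ Θb) (Θ₁ ⊕ Θ₂) ≈ substCtx k Θa Θ₁ ⊕ substCtx k Θb Θ₂
substCtx-⊕ k Θa Θb Θ₁ Θ₂ =
  ≈-trans (⊕-cong (downC-⊕ k Θa Θb) (shiftC-⊕ 0 k Θ₁ Θ₂))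
          (⊕-interchange (downC k Θa) (downC k Θb) (shiftC 0 k Θ₁) (shiftC 0 k Θ₂))

substCtx-∅ : ∀ k → substCtx k ∅ ∅ ≈ ∅
substCtx-∅ k = ≈-trans (⊕-cong (downC-∅ k) (shiftC-∅ 0 k)) (⊕-identityʳ ∅)

substCtx-split : ∀ k {Θ₀ Θa Θb Θx Θ₁ Θ₂} → Θ₀ ≈ Θa ⊕ Θb → Θx ≈ Θ₁ ⊕ Θ₂ →
                 substCtx k Θ₀ Θx ≈ substCtx k Θa Θ₁ ⊕ substCtx k Θb Θ₂
substCtx-split k e f = ≈-trans (substCtx-cong k e f) (substCtx-⊕ k _ _ _ _)

downC-occurrence : ∀ k {Θ₀ y A} → Θ₀ ≈ single y A → (y ≡ᵇ k) ≡ true → downC k Θ₀ ≈ ∅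
downC-occurrence k {y = y} e eq with ≡ᵇ-true⇒≡ y k eq
... | refl = ≈-trans (downC-cong k e) (down-single-same k _)

mutual
  substitution : ∀ k {Θ₀ s B} (D : Θ₀ ⊢ s ∶ B) {Θx xs} → BagTy Θx xs (occTys k D) →
                 substCtx k Θ₀ Θx ⊢ plug k s xs ∶ B
  substitution k (tvar {Θ₀} {y} {A} e) {Θx} b with y ≡ᵇ k in eq
  ... | true with bag-one b
  ...   | x , refl , Dx =
    ⊢-resp-≈ (shift-ty 0 k Dx)
      (≈-sym (≈-trans (⊕-cong (downC-occurrence k {y = y} e eq) ≈-refl) (⊕-identityˡ _)))
  substitution k (tvar {Θ₀} {y} {A} e) {Θx} b | false with bag-nil b
  ...   | refl , f =
    subst (λ t → substCtx k Θ₀ Θx ⊢ t ∶ A) (sym (fill-var-other k y))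
      (tvar (≈-trans (substCtx-cong k e f)
              (≈-trans (⊕-cong (down-single k y A eq) (shiftC-∅ 0 k)) (⊕-identityʳ _))))
  substitution k (tlam {s = s} D p e) {xs = xs} b rewrite fill-lam k s xs =
    tlam (substitution (suc k) D b) (↭-trans p (↭-sym (↭ₚ.++-identityʳ _))) (substCtx-cong k e ≈-refl)
  substitution k (tlamω {s = s} D p e) {xs = xs} b rewrite fill-lam k s xs =
    tlamω (substitution (suc k) D b) (↭-trans (↭ₚ.++-identityʳ _) p) (substCtx-cong k e ≈-refl)
  substitution k (tapp {s = s} {ts} D bt p e) b with bag-split (occTys k D) b
  ... | xs₁ , xs₂ , Θ₁ , Θ₂ , refl , b₁ , b₂ , f
    rewrite plug-app k s ts xs₁ xs₂ (trans (bag-length b₁) (occTys-length k D)) =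
    tapp (substitution k D b₁) (substitutionBag k bt b₂) p (substCtx-split k e f)
  substitution k (tappω {s = s} {ts} D bt e) b with bag-split (occTys k D) b
  ... | xs₁ , xs₂ , Θ₁ , Θ₂ , refl , b₁ , b₂ , f
    rewrite plug-app k s ts xs₁ xs₂ (trans (bag-length b₁) (occTys-length k D)) =
    tappω (substitution k D b₁) (substitutionBag k bt b₂) (substCtx-split k e f)

  substitutionBag : ∀ k {Θb ts Us} (bt : BagTy Θb ts Us) {Θx xs} → BagTy Θx xs (occTysB k bt) →
                    BagTy (substCtx k Θb Θx) (plugs k ts xs) Us
  substitutionBag k (bnil e) b with bag-nil b
  ... | refl , f = bnil (≈-trans (substCtx-cong k e f) (substCtx-∅ k))
  substitutionBag k (bcons {t = t} {ts} D bt e) b with bag-split (occTys k D) b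
  ... | xs₁ , xs₂ , Θ₁ , Θ₂ , refl , b₁ , b₂ , f
    rewrite plugs-cons k t ts xs₁ xs₂ (trans (bag-length b₁) (occTys-length k D)) =
    bcons (substitution k D b₁) (substitutionBag k bt b₂) (substCtx-split k e f)

AntiSubst : ℕ → Ctx → RT → List RT → Ty → Set
AntiSubst k Θ s xs B = Σ Ctx λ Θ₀ → Σ Ctx λ Θx → Σ (List Ty) λ Us →
  (Θ₀ ⊢ s ∶ B) × BagTy Θx xs Us × (Us ↭ Θ₀ k) × (Θ ≈ substCtx k Θ₀ Θx)

AntiSubstBag : ℕ → Ctx → List RT → List RT → List Ty → Set
AntiSubstBag k Θ ts xs Vs = Σ Ctx λ Θ₀ → Σ Ctx λ Θx → Σ (List Ty) λ Us →
  BagTy Θ₀ ts Vs × BagTy Θx xs Us × (Us ↭ Θ₀ k) × (Θ ≈ substCtx k Θ₀ Θx)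

single-hit : ∀ y k B → (y ≡ᵇ k) ≡ true → single y B k ≡ B ∷ []
single-hit y k B eq rewrite eq = refl

single-miss : ∀ y k B → (y ≡ᵇ k) ≡ false → single y B k ≡ []
single-miss y k B eq rewrite eq = refl

substCtx-join : ∀ k {Θ Θ₁ Θ₂ Θa Θb Θx₁ Θx₂} → Θ ≈ Θ₁ ⊕ Θ₂ →
  Θ₁ ≈ substCtx k Θa Θx₁ → Θ₂ ≈ substCtx k Θb Θx₂ → Θ ≈ substCtx k (Θa ⊕ Θb) (Θx₁ ⊕ Θx₂)
substCtx-join k e f₁ f₂ = ≈-trans e (≈-trans (⊕-cong f₁ f₂) (≈-sym (substCtx-⊕ k _ _ _ _)))

antiSubstitution-var : ∀ k y xs {Θ B} → length xs ≡ occ k (rvar y) →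
  Θ ⊢ plug k (rvar y) xs ∶ B → AntiSubst k Θ (rvar y) xs B
antiSubstitution-var k y xs {Θ} {B} e D with y ≡ᵇ k in eq
antiSubstitution-var k y (x ∷ []) {Θ} {B} e D | true with unshift-ty 0 k x D
... | Θx , Dx , f =
  single y B , Θx , B ∷ [] , tvar ≈-refl , bcons Dx (bnil ≈-refl) (≈-sym (⊕-identityʳ Θx)) ,
  ↭-reflexive (sym (single-hit y k B eq)) ,
  ≈-trans f (≈-sym (≈-trans (⊕-cong (downC-occurrence k {y = y} ≈-refl eq) ≈-refl) (⊕-identityˡ _)))
antiSubstitution-var k y [] {Θ} {B} e D | false with subst (λ t → Θ ⊢ t ∶ B) (fill-var-other k y) D
... | tvar f =
  single y B , ∅ , [] , tvar ≈-refl , bnil ≈-refl , ↭-reflexive (sym (single-miss y k B eq)) ,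
  ≈-trans f (≈-sym (≈-trans (⊕-cong (down-single k y B eq) (shiftC-∅ 0 k)) (⊕-identityʳ _)))

mutual
  antiSubstitution : ∀ k s xs {Θ B} → length xs ≡ occ k s → Θ ⊢ plug k s xs ∶ B → AntiSubst k Θ s xs B
  antiSubstitution k (rvar y) xs e D = antiSubstitution-var k y xs e D
  antiSubstitution k (rlam s) xs e D rewrite fill-lam k s xs with D
  ... | tlam D' p f with antiSubstitution (suc k) s xs e D'
  ...   | Θ₀ , Θx , Us , D₀ , bx , q , g =
    tailC Θ₀ , Θx , Us , tlam D₀ (↭-trans p (↭-trans (g 0) (↭ₚ.++-identityʳ (Θ₀ 0)))) ≈-refl ,
    bx , q , ≈-trans f (tail-cong g)
  antiSubstitution k (rlam s) xs e D | tlamω D' p f with antiSubstitution (suc k) s xs e D'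
  ...   | Θ₀ , Θx , Us , D₀ , bx , q , g =
    tailC Θ₀ , Θx , Us ,
    tlamω D₀ (↭-trans (↭-sym (↭ₚ.++-identityʳ (Θ₀ 0))) (↭-trans (↭-sym (g 0)) p)) ≈-refl ,
    bx , q , ≈-trans f (tail-cong g)
  antiSubstitution k (rapp s ts) xs e D with split xs (occ k s) (occs k ts) e
  ... | xs₁ , xs₂ , refl , e₁ , e₂ rewrite plug-app k s ts xs₁ xs₂ e₁ with D
  ...   | tapp D₁ b p f with antiSubstitution k s xs₁ e₁ D₁ | antiSubstitutionBag k ts xs₂ e₂ b
  ...     | Θa , Θx₁ , Us₁ , Da , bx₁ , q₁ , f₁ | Θb , Θx₂ , Us₂ , bb , bx₂ , q₂ , f₂ =
    Θa ⊕ Θb , Θx₁ ⊕ Θx₂ , Us₁ ++ Us₂ , tapp Da bb p ≈-refl , bag-++ bx₁ bx₂ ,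
    ↭ₚ.++⁺ q₁ q₂ , substCtx-join k f f₁ f₂
  antiSubstitution k (rapp s ts) xs e D | xs₁ , xs₂ , refl , e₁ , e₂ | tappω D₁ b f
    with antiSubstitution k s xs₁ e₁ D₁ | antiSubstitutionBag k ts xs₂ e₂ b
  ...     | Θa , Θx₁ , Us₁ , Da , bx₁ , q₁ , f₁ | Θb , Θx₂ , Us₂ , bb , bx₂ , q₂ , f₂ =
    Θa ⊕ Θb , Θx₁ ⊕ Θx₂ , Us₁ ++ Us₂ , tappω Da bb ≈-refl , bag-++ bx₁ bx₂ ,
    ↭ₚ.++⁺ q₁ q₂ , substCtx-join k f f₁ f₂

  antiSubstitutionBag : ∀ k ts xs {Θ Vs} → length xs ≡ occs k ts →
    BagTy Θ (plugs k ts xs) Vs → AntiSubstBag k Θ ts xs Vs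
  antiSubstitutionBag k [] [] e (bnil f) =
    ∅ , ∅ , [] , bnil ≈-refl , bnil ≈-refl , ↭-refl , ≈-trans f (≈-sym (substCtx-∅ k))
  antiSubstitutionBag k (t ∷ ts) xs e b with split xs (occ k t) (occs k ts) e
  ... | xs₁ , xs₂ , refl , e₁ , e₂ rewrite plugs-cons k t ts xs₁ xs₂ e₁ with b
  ...   | bcons D₁ b' f with antiSubstitution k t xs₁ e₁ D₁ | antiSubstitutionBag k ts xs₂ e₂ b'
  ...     | Θa , Θx₁ , Us₁ , Da , bx₁ , q₁ , f₁ | Θb , Θx₂ , Us₂ , bb , bx₂ , q₂ , f₂ =
    Θa ⊕ Θb , Θx₁ ⊕ Θx₂ , Us₁ ++ Us₂ , bcons Da bb ≈-refl , bag-++ bx₁ bx₂ ,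
    ↭ₚ.++⁺ q₁ q₂ , substCtx-join k f f₁ f₂

insertions-↭ : ∀ {A : Set} (x : A) ys {p} → p ∈ insertions x ys → p ↭ x ∷ ys
insertions-↭ x [] (here refl) = ↭-refl
insertions-↭ x (y ∷ ys) (here refl) = ↭-refl
insertions-↭ x (y ∷ ys) (there m) with ∈-map⁻ (y ∷_) m
... | q , m' , refl = ↭-trans (prep y (insertions-↭ x ys m')) (swap y x ↭-refl)

∈-concatMap⁻ : ∀ {A : Set} (x : A) qs {p} → p ∈ concatMap (insertions x) qs →
  Σ (List A) λ q → q ∈ qs × p ∈ insertions x q
∈-concatMap⁻ x (q ∷ qs) m with ∈-++⁻ (insertions x q) m
... | inj₁ m' = q , here refl , m'
... | inj₂ m' with ∈-concatMap⁻ x qs m'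
...   | q' , mq , m'' = q' , there mq , m''

perms-↭ : ∀ {A : Set} (xs : List A) {p} → p ∈ perms xs → p ↭ xs
perms-↭ [] (here refl) = ↭-refl
perms-↭ (x ∷ xs) m with ∈-concatMap⁻ x (perms xs) m
... | q , mq , mi = ↭-trans (insertions-↭ x q mi) (prep x (perms-↭ xs mq))

deriv-summand : ∀ s ts {u} → u ∈ deriv s ts →
  (occ 0 s ≡ length ts) × Σ (List RT) λ p → (p ↭ ts) × (u ≡ plug 0 s p)
deriv-summand s ts m with occ 0 s ≡ᵇ length ts in eq
... | true with ∈-map⁻ (λ p → plug 0 s p) m
...   | p , mp , refl = ≡ᵇ-true⇒≡ _ _ eq , p , perms-↭ ts mp , refl

PermutedBag : Ctx → List RT → List Ty → Set
PermutedBag Θ ts Us = Σ Ctx λ Θ' → Σ (List Ty) λ Us' → BagTy Θ' ts Us' × (Us' ↭ Us) × (Θ' ≈ Θ)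

bag-permute : ∀ {Θ p ts Us} → BagTy Θ p Us → p ↭ ts → PermutedBag Θ ts Us
bag-permute b ↭.refl = _ , _ , b , ↭-refl , ≈-refl
bag-permute (bcons {Θ₁ = Θ₁} D b e) (↭.prep x r) with bag-permute b r
... | Θ' , Us' , b' , q , f = Θ₁ ⊕ Θ' , _ ∷ Us' , bcons D b' ≈-refl , prep _ q , ≈-trans (⊕-cong ≈-refl f) (≈-sym e)
bag-permute (bcons {Θ₁ = Θx} Dx (bcons {Θ₁ = Θy} {Θ₂ = Θb} Dy b e₂) e₁) (↭.swap x y r) with bag-permute b r
... | Θ' , Us' , b' , q , f =
  Θy ⊕ (Θx ⊕ Θ') , _ ∷ _ ∷ Us' , bcons Dy (bcons Dx b' ≈-refl) ≈-refl , swap _ _ q ,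
  ≈-trans (⊕-cong (≈-refl {Θy}) (⊕-cong (≈-refl {Θx}) f))
          (≈-trans (⊕-swapˡ Θy Θx Θb) (≈-sym (≈-trans e₁ (⊕-cong ≈-refl e₂))))
bag-permute b (↭.trans r₁ r₂) with bag-permute b r₁
... | Θ₁ , Us₁ , b₁ , q₁ , f₁ with bag-permute b₁ r₂
...   | Θ₂ , Us₂ , b₂ , q₂ , f₂ = Θ₂ , Us₂ , b₂ , ↭-trans q₂ q₁ , ≈-trans f₂ f₁

β-expansion : ∀ s ts {u Θ A} → u ∈ deriv s ts → Θ ⊢ u ∶ A → Θ ⊢ rapp (rlam s) ts ∶ A
β-expansion s ts m D with deriv-summand s ts m
... | occ≡ , p , p↭ts , refl
  with antiSubstitution 0 s p (trans (↭ₚ.↭-length p↭ts) (sym occ≡)) D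
...   | Θ₀ , Θx , Us , D₀ , bx , q , f with bag-permute bx p↭ts
...     | Θ' , Us' , b' , q' , f' =
  tapp (tlam D₀ ↭-refl ≈-refl) b' (↭-trans q' q) (≈-trans f (⊕-cong ≈-refl (≈-sym f')))

-- σ-expansion: the bag qs moved under the abstraction is typed in a
-- context without index 0, so it can be moved back out.
σ-context : ∀ {Θ Θ₁ Θ₂ Θ' Θa Θb Θq} → Θ ≈ Θ₁ ⊕ Θ₂ → Θ₁ ≈ tailC Θ' → Θ' ≈ Θa ⊕ Θb →
  Θb ≈ consC [] Θq → Θ ≈ (tailC Θa ⊕ Θ₂) ⊕ Θq
σ-context {Θ₂ = Θ₂} {Θa = Θa} {Θq = Θq} e e₁ eb fq =
  ≈-trans e (≈-trans (⊕-cong (≈-trans e₁ (tail-cong (≈-trans eb (⊕-cong ≈-refl fq)))) (≈-refl {Θ₂}))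
                     (⊕-swapʳ (tailC Θa) Θq Θ₂))

σ-used : ∀ {L Θ' Θa Θb Θq} → L ↭ Θ' 0 → Θ' ≈ Θa ⊕ Θb → Θb ≈ consC [] Θq → L ↭ Θa 0
σ-used {Θa = Θa} p eb fq =
  ↭-trans p (↭-trans (eb 0) (↭-trans (↭ₚ.++⁺ˡ (Θa 0) (fq 0)) (↭ₚ.++-identityʳ (Θa 0))))

σ-unused : ∀ {Θ' Θa Θb} → Θ' 0 ↭ [] → Θ' ≈ Θa ⊕ Θb → Θa 0 ↭ []
σ-unused {Θa = Θa} {Θb} p eb =
  ↭-reflexive (++-conicalˡ (Θa 0) (Θb 0) (↭ₚ.↭-empty-inv (↭-trans (↭-sym (eb 0)) p)))

σ-expansion : ∀ s ts qs {Θ A} → Θ ⊢ rapp (rlam (rapp s (shiftRs 0 1 qs))) ts ∶ A →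
  Θ ⊢ rapp (rapp (rlam s) ts) qs ∶ A
σ-expansion s ts qs (tapp (tlam (tapp Ds bq pV eb) pL eL) bt pU e) with unshift-bag 0 1 qs bq
... | Θq , bq' , fq =
  tapp (tapp (tlam Ds (σ-used pL eb fq) ≈-refl) bt pU ≈-refl) bq' pV (σ-context e eL eb fq)
σ-expansion s ts qs (tapp (tlam (tappω Ds bq eb) pL eL) bt pU e) with unshift-bag 0 1 qs bq
... | Θq , bq' , fq =
  tappω (tapp (tlam Ds (σ-used pL eb fq) ≈-refl) bt pU ≈-refl) bq' (σ-context e eL eb fq)
σ-expansion s ts qs (tappω (tlamω (tapp {Θ₁ = Θa} Ds bq pV eb) p0 eL) bt e) with unshift-bag 0 1 qs bq
... | Θq , bq' , fq =
  tapp (tappω (tlamω Ds (σ-unused {Θa = Θa} p0 eb) ≈-refl) bt ≈-refl) bq' pV (σ-context e eL eb fq)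
σ-expansion s ts qs (tappω (tlamω (tappω {Θ₁ = Θa} Ds bq eb) p0 eL) bt e) with unshift-bag 0 1 qs bq
... | Θq , bq' , fq =
  tappω (tappω (tlamω Ds (σ-unused {Θa = Θa} p0 eb) ≈-refl) bt ≈-refl) bq' (σ-context e eL eb fq)

bag-replace : ∀ ts₁ {t t' ts₂ Θ Us} → (∀ {Θ' U} → Θ' ⊢ t' ∶ U → Θ' ⊢ t ∶ U) →
  BagTy Θ (ts₁ ++ t' ∷ ts₂) Us → BagTy Θ (ts₁ ++ t ∷ ts₂) Us
bag-replace [] h (bcons D b e) = bcons (h D) b e
bag-replace (x ∷ ts₁) h (bcons D b e) = bcons D (bag-replace ts₁ h b) e

subjectExpansion : ∀ {s τ} → s ↦ τ → ∀ {u Θ A} → u ∈ τ → Θ ⊢ u ∶ A → Θ ⊢ s ∶ A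
subjectExpansion (∂β s ts _) m D = β-expansion s ts m D
subjectExpansion (∂σ s ts qs) (here refl) D = σ-expansion s ts qs D
subjectExpansion (cLam r) m D with ∈-map⁻ rlam m
subjectExpansion (cLam r) m (tlam D p e) | _ , m' , refl = tlam (subjectExpansion r m' D) p e
subjectExpansion (cLam r) m (tlamω D p e) | _ , m' , refl = tlamω (subjectExpansion r m' D) p e
subjectExpansion (cFun ts r) m D with ∈-map⁻ (λ s' → rapp s' ts) m
subjectExpansion (cFun ts r) m (tapp D b p e) | _ , m' , refl = tapp (subjectExpansion r m' D) b p e
subjectExpansion (cFun ts r) m (tappω D b e) | _ , m' , refl = tappω (subjectExpansion r m' D) b e
subjectExpansion (cArg s ts₁ ts₂ r) m D with ∈-map⁻ (λ t' → rapp s (ts₁ ++ t' ∷ ts₂)) m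
subjectExpansion (cArg s ts₁ ts₂ r) m (tapp D b p e) | _ , m' , refl =
  tapp D (bag-replace ts₁ (subjectExpansion r m') b) p e
subjectExpansion (cArg s ts₁ ts₂ r) m (tappω D b e) | _ , m' , refl =
  tappω D (bag-replace ts₁ (subjectExpansion r m') b) e

NormalTerm : RT → Set
NormalTerm s = ∀ τ → ¬ (s ↦ τ)

-- How normal terms are typed, by shape: a term with a variable head has
-- every type; the others are abstractions or stuck redexes (λx.a) us with
-- x not free in a, which are typable.
data TypedNormal : RT → Set where
  anyType : ∀ {s} → (∀ B → Σ Ctx λ Θ → Θ ⊢ s ∶ B) → TypedNormal s
  typedLam : ∀ {a} → Typable (rlam a) → TypedNormal (rlam a)
  typedStuck : ∀ {a us} → Typable (rapp (rlam a) us) → TypedNormal (rapp (rlam a) us)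

typedNormal⇒typable : ∀ {s} → TypedNormal s → Typable s
typedNormal⇒typable (anyType h) = _ , base , proj₂ (h base)
typedNormal⇒typable (typedLam t) = t
typedNormal⇒typable (typedStuck t) = t

lam-body-typable : ∀ {Θ a T} → Θ ⊢ rlam a ∶ T → Σ Ctx λ Θ' → Σ Ty λ B → Θ' ⊢ a ∶ B
lam-body-typable (tlam D p e) = _ , _ , D
lam-body-typable (tlamω D p e) = _ , _ , D

length≡0⇒[] : ∀ {A : Set} (xs : List A) → length xs ≡ 0 → xs ≡ []
length≡0⇒[] [] e = refl

unused-slot : ∀ {Θ s A} k (D : Θ ⊢ s ∶ A) → occ k s ≡ 0 → Θ k ↭ []
unused-slot k D z =
  ↭-trans (↭-sym (occTys-↭ k D)) (↭-reflexive (length≡0⇒[] _ (trans (occTys-length k D) z)))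

-- A normal application is typed from its typed head and bag: the head is
-- neither a redex (∂σ would fire) nor an abstraction using its variable
-- (∂β would fire).
typed-application : ∀ f ts {Θb Us} → NormalTerm (rapp f ts) → TypedNormal f → BagTy Θb ts Us →
  TypedNormal (rapp f ts)
typed-application f ts n (anyType h) b = anyType (λ B → _ , tapp (proj₂ (h (_ ⟶ B))) b ↭-refl ≈-refl)
typed-application _ ts n (typedStuck _) b = ⊥-elim (n _ (∂σ _ _ ts))
typed-application (rlam a) ts n (typedLam (_ , _ , Dλ)) b with occ 0 a ≟ 0
... | no occurs = ⊥-elim (n _ (∂β a ts occurs))
... | yes unused with lam-body-typable Dλ
...   | _ , B , D = typedStuck (_ , B , tappω (tlamω D (unused-slot 0 D unused) ≈-refl) b ≈-refl)

argument-normal : ∀ {f ts t} → NormalTerm (rapp f ts) → t ∈ ts → NormalTerm t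
argument-normal {f} n m τ r with ∈-∃++ m
... | ts₁ , ts₂ , refl = n _ (cArg f ts₁ ts₂ r)

mutual
  normal-typed : ∀ s → NormalTerm s → TypedNormal s
  normal-typed (rvar y) n = anyType (λ B → single y B , tvar ≈-refl)
  normal-typed (rlam a) n with typedNormal⇒typable (normal-typed a (λ τ r → n _ (cLam r)))
  ... | Θ , B , D = typedLam (tailC Θ , _ , tlam D ↭-refl ≈-refl)
  normal-typed (rapp f ts) n with normal-bag-typed ts (argument-normal n)
  ... | _ , _ , b = typed-application f ts n (normal-typed f (λ τ r → n _ (cFun ts r))) b

  normal-bag-typed : ∀ ts → (∀ {t} → t ∈ ts → NormalTerm t) →
    Σ Ctx λ Θ → Σ (List Ty) λ Us → BagTy Θ ts Us
  normal-bag-typed [] n = ∅ , [] , bnil ≈-refl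
  normal-bag-typed (t ∷ ts) n
    with typedNormal⇒typable (normal-typed t (n (here refl))) | normal-bag-typed ts (λ m → n (there m))
  ... | Θ₁ , U , D | Θ₂ , Us , b = Θ₁ ⊕ Θ₂ , U ∷ Us , bcons D b ≈-refl

SomeTypable : Sum → Set
SomeTypable σ = Σ RT λ u → u ∈ σ × Typable u

step-reflects : ∀ {σ τ} → σ ⇒ τ → SomeTypable τ → SomeTypable σ
step-reflects (step σ₁ σ₂ {s} {τ'} r) (u , m , Θ , A , D) with ∈-++⁻ σ₁ m
... | inj₁ m₁ = u , ∈-++⁺ˡ m₁ , Θ , A , D
... | inj₂ m₂ with ∈-++⁻ τ' m₂
...   | inj₁ m₃ = s , ∈-++⁺ʳ σ₁ (here refl) , Θ , A , subjectExpansion r m₃ D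
...   | inj₂ m₄ = u , ∈-++⁺ʳ σ₁ (there m₄) , Θ , A , D

steps-reflect : ∀ {σ τ} → σ ⇒* τ → SomeTypable τ → SomeTypable σ
steps-reflect ε t = t
steps-reflect (r ◅ rs) t = step-reflects r (steps-reflect rs t)

-- A term whose normal form is non-zero is typable: the normal form has a
-- summand, which is a normal term, hence typable, and typability is
-- reflected along the reduction.
nonzeroNF⇒typable : ∀ s → NFnonzero s → Typable s
nonzeroNF⇒typable s ([] , _ , _ , nonzero) = ⊥-elim (nonzero refl)
nonzeroNF⇒typable s (u ∷ rest , reduces , normal , _)
  with steps-reflect reduces
         (u , here refl , typedNormal⇒typable (normal-typed u (λ τ r → normal _ (step [] rest r))))
... | .s , here refl , t = t

mutual
  shift-∈T : ∀ c d {t N} → t ∈T N → shiftR c d t ∈T shiftΛ c d N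
  shift-∈T c d (tVar y) with y <ᵇ c
  ... | true = tVar y
  ... | false = tVar (y + d)
  shift-∈T c d (tLam h) = tLam (shift-∈T (suc c) d h)
  shift-∈T c d (tApp h hs) = tApp (shift-∈T c d h) (shift-All∈T c d hs)

  shift-All∈T : ∀ c d {ts N} → All (_∈T N) ts → All (_∈T shiftΛ c d N) (shiftRs c d ts)
  shift-All∈T c d [] = []
  shift-All∈T c d (h ∷ hs) = shift-∈T c d h ∷ shift-All∈T c d hs

mutual
  plug-∈T : ∀ k {s M N} xs → s ∈T M → All (_∈T N) xs → length xs ≡ occ k s → plug k s xs ∈T substΛ k M N
  plug-∈T k xs (tVar y) hx e with y ≡ᵇ k
  plug-∈T k (x ∷ []) (tVar y) (h ∷ []) e | true = shift-∈T 0 k h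
  plug-∈T k [] (tVar y) [] e | false with y <ᵇ k
  ... | true = tVar y
  ... | false = tVar (y ∸ 1)
  plug-∈T k xs (tLam {s} h) hx e rewrite fill-lam k s xs = tLam (plug-∈T (suc k) xs h hx e)
  plug-∈T k xs (tApp {s} {ts} h hs) hx e with split xs (occ k s) (occs k ts) e
  ... | xs₁ , xs₂ , refl , e₁ , e₂ rewrite plug-app k s ts xs₁ xs₂ e₁ =
    tApp (plug-∈T k xs₁ h (++⁻ˡ xs₁ hx) e₁) (plugs-∈T k xs₂ hs (++⁻ʳ xs₁ hx) e₂)

  plugs-∈T : ∀ k {ts Q N} xs → All (_∈T Q) ts → All (_∈T N) xs → length xs ≡ occs k ts →
             All (_∈T substΛ k Q N) (plugs k ts xs)
  plugs-∈T k [] [] [] e = []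
  plugs-∈T k xs (_∷_ {t} {ts} h hs) hx e with split xs (occ k t) (occs k ts) e
  ... | xs₁ , xs₂ , refl , e₁ , e₂ rewrite plugs-cons k t ts xs₁ xs₂ e₁ =
    plug-∈T k xs₁ h (++⁻ˡ xs₁ hx) e₁ ∷ plugs-∈T k xs₂ hs (++⁻ʳ xs₁ hx) e₂

mutual
  shift-positive : ∀ c d {t} → Positive t → Positive (shiftR c d t)
  shift-positive c d (pVar y) with y <ᵇ c
  ... | true = pVar y
  ... | false = pVar (y + d)
  shift-positive c d (pLam p) = pLam (shift-positive (suc c) d p)
  shift-positive c d (pApp p (q ∷ qs)) =
    pApp (shift-positive c d p) (shift-positive c d q ∷ shift-All-positive c d qs)

  shift-All-positive : ∀ c d {ts} → All Positive ts → All Positive (shiftRs c d ts)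
  shift-All-positive c d [] = []
  shift-All-positive c d (p ∷ ps) = shift-positive c d p ∷ shift-All-positive c d ps

mutual
  plug-positive : ∀ k s xs → Positive s → All Positive xs → length xs ≡ occ k s → Positive (plug k s xs)
  plug-positive k (rvar y) xs p hx e with y ≡ᵇ k
  plug-positive k (rvar y) (x ∷ []) p (h ∷ []) e | true = shift-positive 0 k h
  plug-positive k (rvar y) [] p [] e | false with y <ᵇ k
  ... | true = pVar y
  ... | false = pVar (y ∸ 1)
  plug-positive k (rlam s) xs (pLam p) hx e rewrite fill-lam k s xs =
    pLam (plug-positive (suc k) s xs p hx e)
  plug-positive k (rapp s (t ∷ ts)) xs (pApp p (pt ∷ pts)) hx e with split xs (occ k s) (occs k (t ∷ ts)) e
  ... | xs₁ , xs₂ , refl , e₁ , e₂ with split xs₂ (occ k t) (occs k ts) e₂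
  ...   | ys₁ , ys₂ , refl , f₁ , f₂
    rewrite plug-app k s (t ∷ ts) xs₁ (ys₁ ++ ys₂) e₁ | plugs-cons k t ts ys₁ ys₂ f₁ =
    pApp (plug-positive k s xs₁ p (++⁻ˡ xs₁ hx) e₁)
         (plug-positive k t ys₁ pt (++⁻ˡ ys₁ hy) f₁ ∷ plugs-positive k ts ys₂ pts (++⁻ʳ ys₁ hy) f₂)
    where hy = ++⁻ʳ xs₁ hx

  plugs-positive : ∀ k ts xs → All Positive ts → All Positive xs → length xs ≡ occs k ts →
                   All Positive (plugs k ts xs)
  plugs-positive k [] [] [] [] e = []
  plugs-positive k (t ∷ ts) xs (p ∷ ps) hx e with split xs (occ k t) (occs k ts) e
  ... | xs₁ , xs₂ , refl , e₁ , e₂ rewrite plugs-cons k t ts xs₁ xs₂ e₁ =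
    plug-positive k t xs₁ p (++⁻ˡ xs₁ hx) e₁ ∷ plugs-positive k ts xs₂ ps (++⁻ʳ xs₁ hx) e₂

mutual
  size : RT → ℕ
  size (rvar _) = 1
  size (rlam s) = suc (size s)
  size (rapp s ts) = suc (size s + sizes ts)

  sizes : List RT → ℕ
  sizes [] = 0
  sizes (t ∷ ts) = size t + sizes ts

sizes≡sum : ∀ ts → sizes ts ≡ sum (map size ts)
sizes≡sum [] = refl
sizes≡sum (t ∷ ts) = cong (size t +_) (sizes≡sum ts)

sizes-↭ : ∀ {ts ts'} → ts ↭ ts' → sizes ts ≡ sizes ts'
sizes-↭ {ts} {ts'} r = trans (sizes≡sum ts) (trans (sum-↭ (↭ₚ.map⁺ size r)) (sym (sizes≡sum ts')))

sizes-++ : ∀ xs ys → sizes (xs ++ ys) ≡ sizes xs + sizes ys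
sizes-++ [] ys = refl
sizes-++ (x ∷ xs) ys = trans (cong (size x +_) (sizes-++ xs ys)) (sym (+-assoc (size x) _ _))

mutual
  shift-size : ∀ c d t → size (shiftR c d t) ≡ size t
  shift-size c d (rvar y) with y <ᵇ c
  ... | true = refl
  ... | false = refl
  shift-size c d (rlam s) = cong suc (shift-size (suc c) d s)
  shift-size c d (rapp s ts) = cong suc (cong₂ _+_ (shift-size c d s) (shift-sizes c d ts))

  shift-sizes : ∀ c d ts → sizes (shiftRs c d ts) ≡ sizes ts
  shift-sizes c d [] = refl
  shift-sizes c d (t ∷ ts) = cong₂ _+_ (shift-size c d t) (shift-sizes c d ts)

interchange-++ : ∀ a b xs₁ xs₂ → (a + sizes xs₁) + (b + sizes xs₂) ≡ (a + b) + sizes (xs₁ ++ xs₂)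
interchange-++ a b xs₁ xs₂ =
  trans (+-interchange a (sizes xs₁) b (sizes xs₂)) (cong ((a + b) +_) (sym (sizes-++ xs₁ xs₂)))

-- Linear substitution does not increase the total size: each occurrence
-- (of size 1) is traded for one substituted term.
mutual
  plug-size : ∀ k s xs → length xs ≡ occ k s → size (plug k s xs) ≤ size s + sizes xs
  plug-size k (rvar y) xs e with y ≡ᵇ k
  plug-size k (rvar y) (x ∷ []) e | true
    rewrite shift-size 0 k x | +-identityʳ (size x) = n≤1+n (size x)
  plug-size k (rvar y) [] e | false with y <ᵇ k
  ... | true = s≤s z≤n
  ... | false = s≤s z≤n
  plug-size k (rlam s) xs e rewrite fill-lam k s xs = s≤s (plug-size (suc k) s xs e)
  plug-size k (rapp s ts) xs e with split xs (occ k s) (occs k ts) e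
  ... | xs₁ , xs₂ , refl , e₁ , e₂ =
    ≤-trans (≤-reflexive (cong size (plug-app k s ts xs₁ xs₂ e₁)))
      (s≤s (≤-trans (+-mono-≤ (plug-size k s xs₁ e₁) (plugs-size k ts xs₂ e₂))
                    (≤-reflexive (interchange-++ (size s) (sizes ts) xs₁ xs₂))))

  plugs-size : ∀ k ts xs → length xs ≡ occs k ts → sizes (plugs k ts xs) ≤ sizes ts + sizes xs
  plugs-size k [] [] e = z≤n
  plugs-size k (t ∷ ts) xs e with split xs (occ k t) (occs k ts) e
  ... | xs₁ , xs₂ , refl , e₁ , e₂ =
    ≤-trans (≤-reflexive (cong sizes (plugs-cons k t ts xs₁ xs₂ e₁)))
      (≤-trans (+-mono-≤ (plug-size k t xs₁ e₁) (plugs-size k ts xs₂ e₂))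
               (≤-reflexive (interchange-++ (size t) (sizes ts) xs₁ xs₂)))

-- A typed spine: the type T consumes the bags one by one down to A, each
-- bag being typed by the argument part of the current arrow (any typing
-- for ω).
data Spine : Ty → List (List RT) → Ty → Set where
  snil : ∀ {A} → Spine A [] A
  sarr : ∀ {Θ ts Us L B bags A} → BagTy Θ ts Us → Us ↭ L → Spine B bags A → Spine (L ⟶ B) (ts ∷ bags) A
  sω : ∀ {Θ ts Us B bags A} → BagTy Θ ts Us → Spine B bags A → Spine (ω B) (ts ∷ bags) A

spine-push : ∀ {Θ f ts T A bags} → Θ ⊢ rapp f ts ∶ T → Spine T bags A →
  Σ Ty λ T' → Σ Ctx λ Θ' → (Θ' ⊢ f ∶ T') × Spine T' (ts ∷ bags) A
spine-push (tapp D b p e) sp = _ , _ , D , sarr b p sp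
spine-push (tappω D b e) sp = _ , _ , D , sω b sp

spine-pop : ∀ {T t ts bags A} → Spine T ((t ∷ ts) ∷ bags) A → Typable t × Σ Ty λ T' → Spine T' bags A
spine-pop (sarr (bcons D b e) p sp) = (_ , _ , D) , _ , sp
spine-pop (sω (bcons D b e) sp) = (_ , _ , D) , _ , sp

bag-reorder-types : ∀ {Θ ts Us V} → BagTy Θ ts Us → Us ↭ V →
  Σ (List RT) λ ts' → (ts' ↭ ts) × Σ Ctx λ Θ' → BagTy Θ' ts' V
bag-reorder-types b ↭.refl = _ , ↭-refl , _ , b
bag-reorder-types (bcons D b e) (↭.prep U r) with bag-reorder-types b r
... | ts' , q , _ , b' = _ ∷ ts' , prep _ q , _ , bcons D b' ≈-refl
bag-reorder-types (bcons Dx (bcons Dy b e₂) e₁) (↭.swap U₁ U₂ r) with bag-reorder-types b r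
... | ts' , q , _ , b' = _ ∷ _ ∷ ts' , swap _ _ q , _ , bcons Dy (bcons Dx b' ≈-refl) ≈-refl
bag-reorder-types b (↭.trans r₁ r₂) with bag-reorder-types b r₁
... | ts₁ , q₁ , _ , b₁ with bag-reorder-types b₁ r₂
...   | ts₂ , q₂ , _ , b₂ = ts₂ , ↭-trans q₂ q₁ , _ , b₂

record Contractum (s₀ : RT) (ts : List RT) (M : Λ) (bags : List (List RT)) (A : Ty) : Set where
  field
    term : RT
    {ctx} : Ctx
    {type} : Ty
    typed : ctx ⊢ term ∶ type
    spine : Spine type bags A
    positive : Positive term
    inTaylor : term ∈T M
    bounded : size term ≤ size s₀ + sizes ts

-- Head contraction along the typing: the bag is reordered to match the
-- occurrence types of x (an ω-typing means x does not occur and the bag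
-- is discarded), then the substitution lemma applies.
contract : ∀ {Θ s₀ ts bags T A M₀ M₁} → Θ ⊢ rlam s₀ ∶ T → Spine T (ts ∷ bags) A →
  Positive s₀ → All Positive ts → s₀ ∈T M₀ → All (_∈T M₁) ts → Contractum s₀ ts (M₀ [ M₁ ]) bags A
contract {s₀ = s₀} (tlam D₀ q _) (sarr b p sp) ps pts hs hts
  with bag-reorder-types b (↭-trans p (↭-trans q (↭-sym (occTys-↭ 0 D₀))))
... | ts' , ts'↭ts , _ , b' = record
  { term = plug 0 s₀ ts'
  ; typed = substitution 0 D₀ b'
  ; spine = sp
  ; positive = plug-positive 0 s₀ ts' ps (↭ₚ.All-resp-↭ (↭-sym ts'↭ts) pts) len
  ; inTaylor = plug-∈T 0 ts' hs (↭ₚ.All-resp-↭ (↭-sym ts'↭ts) hts) len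
  ; bounded = ≤-trans (plug-size 0 s₀ ts' len) (≤-reflexive (cong (size s₀ +_) (sizes-↭ ts'↭ts)))
  }
  where
  len : length ts' ≡ occ 0 s₀
  len = trans (bag-length b') (occTys-length 0 D₀)
contract {s₀ = s₀} (tlamω D₀ q _) (sω _ sp) ps _ hs _ = record
  { term = plug 0 s₀ []
  ; typed = substitution 0 D₀ b₀
  ; spine = sp
  ; positive = plug-positive 0 s₀ [] ps [] len
  ; inTaylor = plug-∈T 0 [] hs [] len
  ; bounded = ≤-trans (plug-size 0 s₀ [] len) (+-monoʳ-≤ (size s₀) z≤n)
  }
  where
  no-occurrence : occTys 0 D₀ ≡ []
  no-occurrence = ↭ₚ.↭-empty-inv (↭-trans (occTys-↭ 0 D₀) q)
  b₀ : BagTy ∅ [] (occTys 0 D₀)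
  b₀ = subst (BagTy ∅ []) (sym no-occurrence) (bnil ≈-refl)
  len : 0 ≡ occ 0 s₀
  len = trans (cong length (sym no-occurrence)) (occTys-length 0 D₀)

bagsSize : List (List RT) → ℕ
bagsSize [] = 0
bagsSize (b ∷ bs) = suc (sizes b) + bagsSize bs

unwind-≡ : ∀ a b c → suc (a + b) + c ≡ a + (suc b + c)
unwind-≡ a b c = trans (cong suc (+-assoc a b c)) (sym (+-suc a (b + c)))

part-bound : ∀ a b c → b ≤ a + (suc b + c)
part-bound a b c = ≤-trans (n≤1+n b) (≤-trans (m≤m+n (suc b) c) (m≤n+m (suc b + c) a))

contract-bound : ∀ {x} a b c → x ≤ a + b → x + c ≤ a + (suc b + c)
contract-bound a b c l =
  ≤-trans (+-monoˡ-≤ c l) (≤-trans (≤-reflexive (+-assoc a b c)) (+-monoʳ-≤ a (n≤1+n (b + c))))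

PositiveBag : List RT → Set
PositiveBag [] = ⊥
PositiveBag (t ∷ ts) = All Positive (t ∷ ts)

BagIn : List RT → Λ → Set
BagIn b N = All (_∈T N) b

mutual
  spine⇒InS : ∀ n h H bags Ns {Θ T A} → size h + bagsSize bags ≤ n → Θ ⊢ h ∶ T → Spine T bags A →
    Positive h → All PositiveBag bags → h ∈T H → Pointwise BagIn bags Ns → InS (apps H Ns)
  spine⇒InS n (rapp f ts) (app F Q) bags Ns le D sp (pApp pf pts) pbs (tApp hf hts) hbs
    with spine-push D sp
  ... | _ , _ , Df , sp' =
    spine⇒InS n f F (ts ∷ bags) (Q ∷ Ns) (≤-trans (≤-reflexive (sym (unwind-≡ _ _ _))) le)
      Df sp' pf (pts ∷ pbs) hf (hts ∷ hbs)
  spine⇒InS (suc n) (rvar x) (var .x) bags Ns (s≤s le) _ sp _ pbs (tVar .x) hbs =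
    sVar x Ns (arguments⇒InS n bags Ns le sp pbs hbs)
  spine⇒InS (suc n) (rlam s₀) (lam M₀) [] [] (s≤s le) D snil (pLam ps) [] (tLam hs) []
    with lam-body-typable D
  ... | _ , _ , D₀ = sLam (spine⇒InS n s₀ M₀ [] [] le D₀ snil ps [] hs [])
  spine⇒InS (suc n) (rlam s₀) (lam M₀) ((t ∷ ts) ∷ bags) (M₁ ∷ Ns) (s≤s le) D sp
            (pLam ps) (pts@(pt ∷ _) ∷ pbs) (tLam hs) (hts@(ht ∷ _) ∷ hbs)
    with spine-pop sp
  ... | (_ , _ , Dt) , _ =
    sRed M₀ M₁ Ns
      (term⇒InS n t M₁ (≤-trans (≤-trans (m≤m+n (size t) (sizes ts)) (part-bound (size s₀) _ _)) le) Dt pt ht)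
      (spine⇒InS n term (M₀ [ M₁ ]) bags Ns (≤-trans (contract-bound (size s₀) _ _ bounded) le)
         typed spine positive pbs inTaylor hbs)
    where open Contractum (contract D sp ps pts hs hts)
  spine⇒InS (suc n) (rlam s₀) (lam M₀) ([] ∷ bags) _ _ _ _ _ (() ∷ _) _ _

  arguments⇒InS : ∀ n bags Ns {T A} → bagsSize bags ≤ n → Spine T bags A → All PositiveBag bags →
    Pointwise BagIn bags Ns → All InS Ns
  arguments⇒InS n [] [] _ _ [] [] = []
  arguments⇒InS n ((t ∷ ts) ∷ bags) (N ∷ Ns) le sp ((pt ∷ _) ∷ pbs) ((ht ∷ _) ∷ hbs) with spine-pop sp
  ... | (_ , _ , Dt) , _ , sp' =
    term⇒InS n t N (≤-trans (≤-trans (m≤m+n (size t) (sizes ts)) (part-bound 0 _ _)) le) Dt pt ht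
    ∷ arguments⇒InS n bags Ns (≤-trans (m≤n+m (bagsSize bags) (suc (sizes (t ∷ ts)))) le) sp' pbs hbs
  arguments⇒InS n ([] ∷ bags) _ _ _ (() ∷ _) _

  term⇒InS : ∀ n t N {Θ U} → size t ≤ n → Θ ⊢ t ∶ U → Positive t → t ∈T N → InS N
  term⇒InS n t N le D p h =
    spine⇒InS n t N [] [] (≤-trans (≤-reflexive (+-identityʳ (size t))) le) D snil p [] h []

typable-positive⇒InS : ∀ {s M} → Typable s → Positive s → s ∈T M → InS M
typable-positive⇒InS {s} {M} (_ , _ , D) = term⇒InS (size s) s M ≤-refl D

mainTheorem7 : (M : Λ) → Σ RT (λ s → Positive s × s ∈T M × NFnonzero s) → InS M
mainTheorem7 M (s , positive , s∈TM , nonzero) =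
  typable-positive⇒InS (nonzeroNF⇒typable s nonzero) positive s∈TM
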